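{- Consider the architecture with two processes $p_1,p_2$, where the environment supplies input $a$ to $p_1$ and input $b$ to $p_2$, $p_1$ has output $x$, $p_2$ has output $y$, and there is no communication between $p_1$ and $p_2$. Then there exists a syntactically safe LTL formula $\varphi$ over $\{a,b,x,y\}$ that is unrealizable in this architecture but for which no finite counterexample exists, i.e., for every finite set $\mathcal{P}\subseteq(2^{\{a,b\}})^\omega$ there are implementations whose induced runs on all $\sigma\in\mathcal{P}$ satisfy $\varphi$.
   Context: Implementations are functions $f_1:(2^{\{a\}})^*\to2^{\{x\}}$ and $f_2:(2^{\{b\}})^*\to2^{\{y\}}$ (finite-state if representable by finite transducers). For $\sigma\in(2^{\{a,b\}})^\omega$ the induced run is $w_t=\sigma_t\cup f_1((\sigma_0\cap\{a\})\cdots(\sigma_{t-1}\cap\{a\}))\cup f_2((\sigma_0\cap\{b\})\cdots(\sigma_{t-1}\cap\{b\}))$. $\varphi$ is realizable if some finite-state implementations make every induced run satisfy $\varphi$, unrealizable otherwise. A finite counterexample is a finite $\mathcal{P}\subseteq(2^{\{a,b\}})^\omega$ such that for all implementations some $\sigma\in\mathcal{P}$ has induced run violating $\varphi$. Syntactically safe LTL formulas are generated by $\varphi::=z\mid\neg z\mid\varphi\vee\varphi\mid\varphi\wedge\varphi\mid\mathsf{X}\varphi\mid\mathsf{G}\varphi\mid\varphi\,\mathsf{R}\,\varphi$. -}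

module Defs where

import Data.Nat as ℕ
open import Data.Nat using (ℕ; _≤_; _<_)
open import Data.Bool using (Bool; true; false)
open import Data.Fin using (Fin)
open import Data.List using (List; []; _∷_; foldl; map)
open import Data.Product using (Σ; _×_; proj₁; proj₂; ∃-syntax)
open import Data.Sum using (_⊎_)
open import Relation.Binary.PropositionalEquality using (_≡_)
open import Relation.Nullary using (¬_)
open import Data.List.Relation.Unary.All using (All)
import Data.List.Relation.Unary.Any
import Data.List

data AP : Set where
  a b x y : AP

Letter : Set
Letter = AP → Bool

Word : Set
Word = ℕ → Letter

data SafeLTL : Set where
  atom    : AP → SafeLTL
  negatom : AP → SafeLTL
  _∨ˢ_    : SafeLTL → SafeLTL → SafeLTL
  _∧ˢ_    : SafeLTL → SafeLTL → SafeLTL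
  Xˢ      : SafeLTL → SafeLTL
  Gˢ      : SafeLTL → SafeLTL
  _Rˢ_    : SafeLTL → SafeLTL → SafeLTL

Sat : Word → SafeLTL → ℕ → Set
Sat w (atom p)    t = w t p ≡ true
Sat w (negatom p) t = w t p ≡ false
Sat w (φ ∨ˢ ψ)    t = Sat w φ t ⊎ Sat w ψ t
Sat w (φ ∧ˢ ψ)    t = Sat w φ t × Sat w ψ t
Sat w (Xˢ φ)      t = Sat w φ (ℕ.suc t)
Sat w (Gˢ φ)      t = ∀ j → t ≤ j → Sat w φ j
Sat w (φ Rˢ ψ)    t = ∀ j → t ≤ j → Sat w ψ j ⊎ (∃[ i ] (t ≤ i × i < j × Sat w φ i))

_⊨_ : Word → SafeLTL → Set
w ⊨ φ = Sat w φ 0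

-- Input words over 2^{a,b}: σ t = (a ∈ σ_t , b ∈ σ_t)
InWord : Set
InWord = ℕ → Bool × Bool

-- Implementations: f₁ : (2^{a})^* → 2^{x}, f₂ : (2^{b})^* → 2^{y}
-- (a letter of 2^{a} is a Bool; output Bool tells whether x (resp. y) is set)
Impl : Set
Impl = List Bool → Bool

prefix : {A : Set} → (ℕ → A) → ℕ → List A
prefix σ ℕ.zero    = []
prefix σ (ℕ.suc t) = Data.List._++_ (prefix σ t) (σ t ∷ [])

-- Induced run w_t = σ_t ∪ f₁(σ_0∩{a} ⋯ σ_{t-1}∩{a}) ∪ f₂(σ_0∩{b} ⋯ σ_{t-1}∩{b})
run : Impl → Impl → InWord → Word
run f₁ f₂ σ t a = proj₁ (σ t)
run f₁ f₂ σ t b = proj₂ (σ t)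
run f₁ f₂ σ t x = f₁ (prefix (λ i → proj₁ (σ i)) t)
run f₁ f₂ σ t y = f₂ (prefix (λ i → proj₂ (σ i)) t)

-- Finite-state: representable by a finite transducer (Moore machine over
-- input alphabet Bool with n states; output read from the state reached
-- after consuming the history).
FiniteState : Impl → Set
FiniteState f =
  Σ ℕ λ n → Σ (Fin n) λ q₀ → Σ (Fin n → Bool → Fin n) λ δ → Σ (Fin n → Bool) λ out →
    ∀ (u : List Bool) → f u ≡ out (foldl δ q₀ u)

Realizable : SafeLTL → Set
Realizable φ = Σ Impl λ f₁ → Σ Impl λ f₂ → FiniteState f₁ × FiniteState f₂ ×
  (∀ (σ : InWord) → run f₁ f₂ σ ⊨ φ)

-- The first conjunct of φ makes f₁ u = f₂ v whenever v arises from u by replacing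
-- disjoint adjacent blocks 10 by 01.  Taking u = v as well, f₁ is invariant under
-- such replacements, which turns 1ᵏ0ᵏs into (10)ᵏs.  The other two conjuncts make
-- f₁ accept (10)ᵏ⁺¹ and reject (10)ᵏ⁺¹0ᵈ⁺¹, so f₁ accepts 1ⁿ0ⁿ and rejects 1ⁿ0ᵐ
-- for 0 < n < m, which a finite automaton cannot do.  Yet the infinite-state
-- implementation "the history has as many 0s as 1s" satisfies φ on every input,
-- so no finite set of inputs refutes all implementations.
module Submission where

open import Defs
open import Data.Bool using (Bool; true; false; _∧_; not)
open import Data.Bool.Properties using (not-¬)
open import Data.Empty using (⊥-elim)
open import Data.Fin using (toℕ)
open import Data.Fin.Properties using (pigeonhole)
open import Data.List using (List; []; _∷_; _++_; [_]; length; foldl; replicate)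
open import Data.List.Properties using (foldl-++; length-++; ++-assoc; ++-identityʳ; ++-conicalʳ)
open import Data.List.Relation.Unary.All using (All)
import Data.List.Relation.Unary.All as All
open import Data.Nat using (ℕ; zero; suc; _+_; _≤_; _<_; _≤′_; ≤′-refl; ≤′-step; z≤n; s≤s; z<s)
open import Data.Nat.Properties
  using ( _≟_; +-comm; +-suc; +-identityʳ; suc-injective; ≤-refl; ≤⇒≤′; ≤′⇒≤; m≤n⇒m≤1+n
        ; m<n⇒m<1+n; n<1+n; m<m+n; <⇒≢; m≤n⇒∃[o]m+o≡n)
open import Data.Product using (Σ; _×_; _,_; proj₁; proj₂; ∃-syntax; ∃₂)
open import Data.Sum using (_⊎_; inj₁; inj₂; map₁; map₂)
open import Function using (_∘_)
open import Relation.Nullary using (¬_; does)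
open import Relation.Nullary.Decidable using (dec-true; dec-false)
open import Relation.Binary.PropositionalEquality
  using (_≡_; _≢_; refl; sym; trans; cong; subst; module ≡-Reasoning)
open ≡-Reasoning

≡⇒both-or-neither : ∀ {p q : Bool} → p ≡ q → (p ≡ true × q ≡ true) ⊎ (p ≡ false × q ≡ false)
≡⇒both-or-neither {true}  refl = inj₁ (refl , refl)
≡⇒both-or-neither {false} refl = inj₂ (refl , refl)

both-or-neither⇒≡ : ∀ {p q : Bool} → (p ≡ true × q ≡ true) ⊎ (p ≡ false × q ≡ false) → p ≡ q
both-or-neither⇒≡ (inj₁ (p≡true , q≡true))   = trans p≡true (sym q≡true)
both-or-neither⇒≡ (inj₂ (p≡false , q≡false)) = trans p≡false (sym q≡false)

onlyA onlyB notOnlyA notOnlyB mismatch sameOutputs agreeNext agreement : SafeLTL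
onlyA       = atom a ∧ˢ negatom b
onlyB       = negatom a ∧ˢ atom b
notOnlyA    = negatom a ∨ˢ atom b
notOnlyB    = atom a ∨ˢ negatom b
mismatch    = (onlyA ∧ˢ Xˢ notOnlyB) ∨ˢ (notOnlyA ∧ˢ Xˢ onlyB)
sameOutputs = (atom x ∧ˢ atom y) ∨ˢ (negatom x ∧ˢ negatom y)
agreeNext   = onlyA ∨ˢ Xˢ sameOutputs
agreement   = onlyB ∨ˢ (mismatch Rˢ agreeNext)

aRepeats aTwice xAfterZero notXAfterZeros alternationAccepted zerosRejected φ : SafeLTL
aRepeats            = (atom a ∧ˢ Xˢ (atom a)) ∨ˢ (negatom a ∧ˢ Xˢ (negatom a))
aTwice              = atom a ∧ˢ Xˢ (atom a)
xAfterZero          = atom a ∨ˢ Xˢ (atom x)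
notXAfterZeros      = atom a ∨ˢ Xˢ (atom a ∨ˢ Xˢ (negatom x))
alternationAccepted = negatom a ∨ˢ (aRepeats Rˢ xAfterZero)
zerosRejected       = aTwice Rˢ notXAfterZeros
φ                   = agreement ∧ˢ (alternationAccepted ∧ˢ zerosRejected)

release-intro : ∀ {w φ ψ t} (I : ℕ → Set) → I t →
                (∀ j → I j → Sat w φ j ⊎ I (suc j)) → (∀ j → I j → Sat w ψ j) →
                Sat w (φ Rˢ ψ) t
release-intro {w} {φ} {ψ} {t} I It step guarantee j t≤j = map₁ (guarantee j) (reach (≤⇒≤′ t≤j))
  where
    reach : ∀ {j} → t ≤′ j → I j ⊎ ∃[ i ] (t ≤ i × i < j × Sat w φ i)
    reach ≤′-refl = inj₁ It
    reach (≤′-step t≤′j) with reach t≤′j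
    ... | inj₂ (i , t≤i , i<j , φi) = inj₂ (i , t≤i , m<n⇒m<1+n i<j , φi)
    ... | inj₁ Ij with step _ Ij
    ...   | inj₁ φj  = inj₂ (_ , ≤′⇒≤ t≤′j , n<1+n _ , φj)
    ...   | inj₂ Ij′ = inj₁ Ij′

release-elim : ∀ {w φ ψ t j} → Sat w (φ Rˢ ψ) t → t ≤ j →
               (∀ i → t ≤ i → i < j → ¬ Sat w φ i) → Sat w ψ j
release-elim r t≤j unreleased with r _ t≤j
... | inj₁ ψj = ψj
... | inj₂ (i , t≤i , i<j , φi) = ⊥-elim (unreleased i t≤i i<j φi)

bit : Bool → ℕ
bit false = 0
bit true  = 1

trues : List Bool → ℕ
trues = foldl (λ n c → bit c + n) 0

truesBelow : (ℕ → Bool) → ℕ → ℕ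
truesBelow s zero    = zero
truesBelow s (suc t) = bit (s t) + truesBelow s t

trues-prefix : ∀ s t → trues (prefix s t) ≡ truesBelow s t
trues-prefix s zero    = refl
trues-prefix s (suc t) = begin
  trues (prefix s t ++ [ s t ])     ≡⟨ foldl-++ _ 0 (prefix s t) [ s t ] ⟩
  bit (s t) + trues (prefix s t)    ≡⟨ cong (bit (s t) +_) (trues-prefix s t) ⟩
  bit (s t) + truesBelow s t        ∎

length-prefix : ∀ {A : Set} (s : ℕ → A) t → length (prefix s t) ≡ t
length-prefix s zero    = refl
length-prefix s (suc t) = begin
  length (prefix s t ++ [ s t ])    ≡⟨ length-++ (prefix s t) ⟩
  length (prefix s t) + 1           ≡⟨ cong (_+ 1) (length-prefix s t) ⟩
  t + 1                             ≡⟨ +-comm t 1 ⟩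
  suc t                             ∎

balanced : List Bool → Bool
balanced u = does (trues u + trues u ≟ length u)

balanced-prefix : ∀ s t → balanced (prefix s t) ≡ does (truesBelow s t + truesBelow s t ≟ t)
balanced-prefix s t rewrite trues-prefix s t | length-prefix s t = refl

-- Realizability by an infinite-state implementation

-- Until the first mismatch, a has been true exactly surplus w j more often than b
-- among the first j + 1 letters; so whenever onlyA fails, both histories are
-- equally balanced and the outputs agree.
surplus : Word → ℕ → ℕ
surplus w j = bit (w j a ∧ not (w j b))

surplus-base : ∀ (w : Word) → Sat w onlyB 0 ⊎ bit (w 0 a) + 0 ≡ surplus w 0 + (bit (w 0 b) + 0)
surplus-base w with w 0 a | w 0 b
... | false | true  = inj₁ (refl , refl)
... | false | false = inj₂ refl
... | true  | false = inj₂ refl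
... | true  | true  = inj₂ refl

surplus-step : ∀ (w : Word) j {m n} → m ≡ surplus w j + n →
               Sat w mismatch j ⊎ bit (w (suc j) a) + m ≡ surplus w (suc j) + (bit (w (suc j) b) + n)
surplus-step w j m≡ with w j a | w j b | w (suc j) a | w (suc j) b | m≡
... | true  | false | false | true  | refl = inj₂ refl
... | true  | false | true  | _     | _    = inj₁ (inj₁ ((refl , refl) , inj₁ refl))
... | true  | false | false | false | _    = inj₁ (inj₁ ((refl , refl) , inj₂ refl))
... | false | _     | false | true  | _    = inj₁ (inj₂ (inj₁ refl , refl , refl))
... | true  | true  | false | true  | _    = inj₁ (inj₂ (inj₂ refl , refl , refl))
... | false | _     | true  | true  | refl = inj₂ refl
... | false | _     | true  | false | refl = inj₂ refl
... | false | _     | false | false | refl = inj₂ refl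
... | true  | true  | true  | true  | refl = inj₂ refl
... | true  | true  | true  | false | refl = inj₂ refl
... | true  | true  | false | false | refl = inj₂ refl

onlyA-or-no-surplus : ∀ (w : Word) j → Sat w onlyA j ⊎ surplus w j ≡ 0
onlyA-or-no-surplus w j with w j a | w j b
... | true  | false = inj₁ (refl , refl)
... | true  | true  = inj₂ refl
... | false | _     = inj₂ refl

true-or-bit≡0 : ∀ c → c ≡ true ⊎ bit c ≡ 0
true-or-bit≡0 true  = inj₁ refl
true-or-bit≡0 false = inj₂ refl

alternation-base : ∀ (w : Word) → let m = bit (w 0 a) + 0 in
                   Sat w (negatom a) 0 ⊎ m + m ≡ bit (w 0 a) + 1
alternation-base w with w 0 a
... | false = inj₁ refl
... | true  = inj₂ refl

alternation-step : ∀ (w : Word) j {m} → m + m ≡ bit (w j a) + suc j →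
                   let m′ = bit (w (suc j) a) + m in
                   Sat w aRepeats j ⊎ m′ + m′ ≡ bit (w (suc j) a) + suc (suc j)
alternation-step w j {m} e with w j a | w (suc j) a
... | true  | true  = inj₁ (inj₁ (refl , refl))
... | false | false = inj₁ (inj₂ (refl , refl))
... | true  | false = inj₂ e
... | false | true  = inj₂ (cong suc (trans (+-suc m m) (cong suc e)))

zeros-base : ∀ c → let m = bit c + 0 in m + m ≤ bit c + 1
zeros-base true  = ≤-refl
zeros-base false = z≤n

zeros-step : ∀ (w : Word) j {m} → m + m ≤ bit (w j a) + suc j →
             let m′ = bit (w (suc j) a) + m in
             Sat w aTwice j ⊎ m′ + m′ ≤ bit (w (suc j) a) + suc (suc j)
zeros-step w j {m} le with w j a | w (suc j) a
... | true  | true  = inj₁ (refl , refl)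
... | true  | false = inj₂ le
... | false | false = inj₂ (m≤n⇒m≤1+n le)
... | false | true  = inj₂ (s≤s (subst (_≤ suc (suc j)) (sym (+-suc m m)) (s≤s le)))

balanced-realizes : ∀ σ → run balanced balanced σ ⊨ φ
balanced-realizes σ = agreement-holds , alternation-holds , zeros-hold
  where
    w : Word
    w = run balanced balanced σ
    A B : ℕ → Bool
    A i = w i a
    B i = w i b

    A-lead A-half A-at-most-half : ℕ → Set
    A-lead j         = truesBelow A (suc j) ≡ surplus w j + truesBelow B (suc j)
    A-half j         = truesBelow A (suc j) + truesBelow A (suc j) ≡ bit (A j) + suc j
    A-at-most-half j = truesBelow A (suc j) + truesBelow A (suc j) ≤ bit (A j) + suc j

    agreement-guarantee : ∀ j → A-lead j → Sat w agreeNext j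
    agreement-guarantee j lead with onlyA-or-no-surplus w j
    ... | inj₁ onlyAⱼ     = inj₁ onlyAⱼ
    ... | inj₂ no-surplus = inj₂ (≡⇒both-or-neither (begin
      balanced (prefix A (suc j))  ≡⟨ balanced-prefix A (suc j) ⟩
      does (tA + tA ≟ suc j)       ≡⟨ cong (λ n → does (n + n ≟ suc j)) (trans lead (cong (_+ tB) no-surplus)) ⟩
      does (tB + tB ≟ suc j)       ≡⟨ balanced-prefix B (suc j) ⟨
      balanced (prefix B (suc j))  ∎))
      where
        tA = truesBelow A (suc j)
        tB = truesBelow B (suc j)

    alternation-guarantee : ∀ j → A-half j → Sat w xAfterZero j
    alternation-guarantee j half = map₂ (λ Aj≡0 →
      trans (balanced-prefix A (suc j)) (dec-true (_ ≟ _) (trans half (cong (_+ suc j) Aj≡0))))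
      (true-or-bit≡0 (A j))

    zeros-guarantee : ∀ j → A-at-most-half j → Sat w notXAfterZeros j
    zeros-guarantee j le with true-or-bit≡0 (A j) | true-or-bit≡0 (A (suc j))
    ... | inj₁ Aj      | _           = inj₁ Aj
    ... | inj₂ _       | inj₁ Aj′    = inj₂ (inj₁ Aj′)
    ... | inj₂ Aj≡0    | inj₂ Aj′≡0 =
      inj₂ (inj₂ (trans (balanced-prefix A (suc (suc j))) (dec-false (_ ≟ _) (<⇒≢ too-few))))
      where
        t = truesBelow A (suc j)
        too-few : (bit (A (suc j)) + t) + (bit (A (suc j)) + t) < suc (suc j)
        too-few = subst (λ n → n + n < suc (suc j)) (sym (cong (_+ t) Aj′≡0))
                    (s≤s (subst (λ n → t + t ≤ n + suc j) Aj≡0 le))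

    agreement-holds : w ⊨ agreement
    agreement-holds = map₂
      (λ lead₀ → release-intro {w} {mismatch} {agreeNext} A-lead lead₀
                   (λ j → surplus-step w j) agreement-guarantee)
      (surplus-base w)

    alternation-holds : w ⊨ alternationAccepted
    alternation-holds = map₂
      (λ half₀ → release-intro {w} {aRepeats} {xAfterZero} A-half half₀
                   (λ j → alternation-step w j) alternation-guarantee)
      (alternation-base w)

    zeros-hold : w ⊨ zerosRejected
    zeros-hold = release-intro {w} {aTwice} {notXAfterZeros} A-at-most-half
                   (zeros-base (A 0)) (λ j → zeros-step w j) zeros-guarantee

-- Unrealizability by finite-state implementations

pad : {A : Set} → A → List A → ℕ → A
pad c []      i       = c
pad c (d ∷ u) zero    = d
pad c (d ∷ u) (suc i) = pad c u i

prefix-suc : ∀ {A : Set} (s : ℕ → A) t → prefix s (suc t) ≡ s 0 ∷ prefix (s ∘ suc) t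
prefix-suc s zero    = refl
prefix-suc s (suc t) = cong (_++ [ s (suc t) ]) (prefix-suc s t)

prefix-pad : ∀ {A : Set} (c : A) u d → prefix (pad c u) (length u + d) ≡ u ++ replicate d c
prefix-pad c []      zero    = refl
prefix-pad c []      (suc d) = trans (prefix-suc (pad c []) d) (cong (c ∷_) (prefix-pad c [] d))
prefix-pad c (e ∷ u) d       =
  trans (prefix-suc (pad c (e ∷ u)) (length u + d)) (cong (e ∷_) (prefix-pad c u d))

prefix-pad-length : ∀ {A : Set} (c : A) u → prefix (pad c u) (length u) ≡ u
prefix-pad-length c u = begin
  prefix (pad c u) (length u)       ≡⟨ cong (prefix (pad c u)) (+-identityʳ (length u)) ⟨
  prefix (pad c u) (length u + 0)   ≡⟨ prefix-pad c u 0 ⟩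
  u ++ []                           ≡⟨ ++-identityʳ u ⟩
  u                                 ∎

inputs : List Bool → List Bool → InWord
inputs u v i = pad false u i , pad false v i

-- The pairs of a- and b-histories along which agreement never sees a mismatch.
data Matched : List Bool → List Bool → Set where
  []   : Matched [] []
  same : ∀ c {u v} → Matched u v → Matched (c ∷ u) (c ∷ v)
  swap : ∀ {u v} → Matched u v → Matched (true ∷ false ∷ u) (false ∷ true ∷ v)

Matched-refl : ∀ u → Matched u u
Matched-refl []      = []
Matched-refl (c ∷ u) = same c (Matched-refl u)

Matched-++ : ∀ p {u v} → Matched u v → Matched (p ++ u) (p ++ v)
Matched-++ []      m = m
Matched-++ (c ∷ p) m = same c (Matched-++ p m)

Matched-length : ∀ {u v} → Matched u v → length u ≡ length v
Matched-length []       = refl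
Matched-length (same c m) = cong suc (Matched-length m)
Matched-length (swap m) = cong (suc ∘ suc) (Matched-length m)

alternating : ℕ → List Bool
alternating zero    = []
alternating (suc k) = true ∷ false ∷ alternating k

alternating-tail : ∀ k n → suc (length (alternating k)) ≤ n → pad false (alternating (suc k)) n ≡ false
alternating-tail zero    (suc zero)    _ = refl
alternating-tail zero    (suc (suc n)) _ = refl
alternating-tail (suc k) (suc (suc n)) (s≤s (s≤s le)) = alternating-tail k n le

Matched-shift : ∀ k s → Matched (alternating k ++ false ∷ s) (false ∷ alternating k ++ s)
Matched-shift zero    s = Matched-refl (false ∷ s)
Matched-shift (suc k) s = swap (Matched-shift k s)

module Inputs (f₁ f₂ : Impl) where

  runOn : List Bool → List Bool → Word
  runOn u v = run f₁ f₂ (inputs u v)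

  Matched-head : ∀ {u v} → Matched u v → ¬ Sat (runOn u v) onlyB 0
  Matched-head []         (_ , ())
  Matched-head (same c m) (c≡false , c≡true) = not-¬ c≡true c≡false
  Matched-head (swap m)   (() , _)

  Matched-unbroken : ∀ {u v} → Matched u v → ∀ i → ¬ Sat (runOn u v) mismatch i
  Matched-unbroken []         i (inj₁ ((() , _) , _))
  Matched-unbroken []         i (inj₂ (_ , _ , ()))
  Matched-unbroken (same c m) zero (inj₁ ((c≡true , c≡false) , _)) = not-¬ c≡true c≡false
  Matched-unbroken (same c m) zero (inj₂ (_ , onlyB₁)) = Matched-head m onlyB₁
  Matched-unbroken (same c m) (suc i) = Matched-unbroken m i
  Matched-unbroken (swap m) zero (inj₁ (_ , inj₁ ()))
  Matched-unbroken (swap m) zero (inj₁ (_ , inj₂ ()))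
  Matched-unbroken (swap m) zero (inj₂ (inj₁ () , _))
  Matched-unbroken (swap m) zero (inj₂ (inj₂ () , _))
  Matched-unbroken (swap m) (suc zero) (inj₁ ((() , _) , _))
  Matched-unbroken (swap m) (suc zero) (inj₂ (_ , onlyB₂)) = Matched-head m onlyB₂
  Matched-unbroken (swap m) (suc (suc i)) = Matched-unbroken m i

  Matched-last : ∀ {u v} → Matched u v → ∀ j → suc j ≡ length u → ¬ Sat (runOn u v) onlyA j
  Matched-last (same c m) zero    _ (c≡true , c≡false) = not-¬ c≡true c≡false
  Matched-last (same c m) (suc j) e = Matched-last m j (suc-injective e)
  Matched-last (swap m) (suc zero) _ (() , _)
  Matched-last (swap m) (suc (suc j)) e = Matched-last m j (suc-injective (suc-injective e))

  alternating-no-aTwice : ∀ k i → ¬ Sat (runOn (alternating k) (alternating k)) aTwice i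
  alternating-no-aTwice zero    i             (() , _)
  alternating-no-aTwice (suc k) zero          (_ , ())
  alternating-no-aTwice (suc k) (suc zero)    (() , _)
  alternating-no-aTwice (suc k) (suc (suc i)) = alternating-no-aTwice k i

  alternating-no-aRepeats : ∀ k i → i < suc (length (alternating k)) →
                            ¬ Sat (runOn (alternating (suc k)) (alternating (suc k))) aRepeats i
  alternating-no-aRepeats k       zero _ (inj₁ (_ , ()))
  alternating-no-aRepeats k       zero _ (inj₂ (() , _))
  alternating-no-aRepeats zero    (suc zero) (s≤s ())
  alternating-no-aRepeats (suc k) (suc zero) _ (inj₁ (() , _))
  alternating-no-aRepeats (suc k) (suc zero) _ (inj₂ (_ , ()))
  alternating-no-aRepeats (suc k) (suc (suc i)) (s≤s (s≤s i<)) = alternating-no-aRepeats k i i<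

∷-replicate : ∀ {A : Set} k (c : A) s → c ∷ replicate k c ++ s ≡ replicate k c ++ c ∷ s
∷-replicate zero    c s = refl
∷-replicate (suc k) c s = cong (c ∷_) (∷-replicate k c s)

replicate-+ : ∀ {A : Set} m n (c : A) → replicate (m + n) c ≡ replicate m c ++ replicate n c
replicate-+ zero    n c = refl
replicate-+ (suc m) n c = cong (c ∷_) (replicate-+ m n c)

++-∷-≢-[] : ∀ {A : Set} (p : List A) {c s} → p ++ c ∷ s ≢ []
++-∷-≢-[] p e with ++-conicalʳ p _ e
... | ()

finiteState-collision : ∀ {f} → FiniteState f → (ws : ℕ → List Bool) →
                        ∃₂ λ i j → i < j × ∀ u → f (ws i ++ u) ≡ f (ws j ++ u)
finiteState-collision {f} (n , q₀ , δ , out , f≡out) ws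
  with pigeonhole (n<1+n n) (λ i → foldl δ q₀ (ws (toℕ i)))
... | i , j , i<j , same-state = toℕ i , toℕ j , i<j , λ u → begin
  f (ws (toℕ i) ++ u)                          ≡⟨ f≡out _ ⟩
  out (foldl δ q₀ (ws (toℕ i) ++ u))           ≡⟨ cong out (foldl-++ δ q₀ (ws (toℕ i)) u) ⟩
  out (foldl δ (foldl δ q₀ (ws (toℕ i))) u)    ≡⟨ cong (λ q → out (foldl δ q u)) same-state ⟩
  out (foldl δ (foldl δ q₀ (ws (toℕ j))) u)    ≡⟨ cong out (foldl-++ δ q₀ (ws (toℕ j)) u) ⟨
  out (foldl δ q₀ (ws (toℕ j) ++ u))           ≡⟨ f≡out _ ⟨
  f (ws (toℕ j) ++ u)                          ∎

module Satisfying (f₁ f₂ : Impl) (sat : ∀ σ → run f₁ f₂ σ ⊨ φ) where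

  open Inputs f₁ f₂

  Matched-agree : ∀ {u v} → Matched u v → u ≢ [] → f₁ u ≡ f₂ v
  Matched-agree {[]}    _ u≢[] = ⊥-elim (u≢[] refl)
  Matched-agree {c ∷ u} {v} m _ with proj₁ (sat (inputs (c ∷ u) v))
  ... | inj₁ onlyB₀ = ⊥-elim (Matched-head m onlyB₀)
  ... | inj₂ r with release-elim {runOn (c ∷ u) v} {mismatch} {agreeNext} {j = length u}
                      r z≤n (λ i _ _ → Matched-unbroken m i)
  ...   | inj₁ onlyAₙ = ⊥-elim (Matched-last m (length u) refl onlyAₙ)
  ...   | inj₂ same-outputs = begin
    f₁ (c ∷ u)                                        ≡⟨ cong f₁ (prefix-pad-length false (c ∷ u)) ⟨
    f₁ (prefix (pad false (c ∷ u)) (suc (length u)))  ≡⟨ both-or-neither⇒≡ same-outputs ⟩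
    f₂ (prefix (pad false v) (suc (length u)))        ≡⟨ cong (f₂ ∘ prefix (pad false v)) (Matched-length m) ⟩
    f₂ (prefix (pad false v) (length v))              ≡⟨ cong f₂ (prefix-pad-length false v) ⟩
    f₂ v                                              ∎

  agree : ∀ u → u ≢ [] → f₁ u ≡ f₂ u
  agree u = Matched-agree (Matched-refl u)

  shift-invariant : ∀ p k s →
                    f₁ (p ++ true ∷ alternating k ++ false ∷ s) ≡ f₁ (p ++ alternating (suc k) ++ s)
  shift-invariant p k s = begin
    f₁ (p ++ true ∷ alternating k ++ false ∷ s)
      ≡⟨ Matched-agree (Matched-++ p (same true (Matched-shift k s))) (++-∷-≢-[] p) ⟩
    f₂ (p ++ alternating (suc k) ++ s)
      ≡⟨ agree _ (++-∷-≢-[] p) ⟨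
    f₁ (p ++ alternating (suc k) ++ s) ∎

  sorted-invariant : ∀ k p s →
                     f₁ (p ++ replicate k true ++ replicate k false ++ s) ≡ f₁ (p ++ alternating k ++ s)
  sorted-invariant zero    p s = refl
  sorted-invariant (suc k) p s = begin
    f₁ (p ++ true ∷ replicate k true ++ false ∷ replicate k false ++ s)
      ≡⟨ cong (λ z → f₁ (p ++ true ∷ replicate k true ++ z)) (∷-replicate k false s) ⟩
    f₁ (p ++ true ∷ replicate k true ++ replicate k false ++ false ∷ s)
      ≡⟨ cong f₁ (++-assoc p [ true ] _) ⟨
    f₁ ((p ++ [ true ]) ++ replicate k true ++ replicate k false ++ false ∷ s)
      ≡⟨ sorted-invariant k (p ++ [ true ]) (false ∷ s) ⟩
    f₁ ((p ++ [ true ]) ++ alternating k ++ false ∷ s)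
      ≡⟨ cong f₁ (++-assoc p [ true ] _) ⟩
    f₁ (p ++ true ∷ alternating k ++ false ∷ s)
      ≡⟨ shift-invariant p k s ⟩
    f₁ (p ++ alternating (suc k) ++ s) ∎

  alternating-accepted : ∀ k → f₁ (alternating (suc k)) ≡ true
  alternating-accepted k with proj₁ (proj₂ (sat (inputs (alternating (suc k)) (alternating (suc k)))))
  ... | inj₁ ()
  ... | inj₂ r with release-elim {runOn (alternating (suc k)) (alternating (suc k))} {aRepeats} {xAfterZero}
                      {j = suc (length (alternating k))} r z≤n (λ i _ → alternating-no-aRepeats k i)
  ...   | inj₁ a≡true = ⊥-elim (not-¬ a≡true (alternating-tail k _ ≤-refl))
  ...   | inj₂ x≡true = trans (cong f₁ (sym (prefix-pad-length false (alternating (suc k))))) x≡true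

  alternating-zeros-rejected : ∀ k d → f₁ (alternating (suc k) ++ replicate (suc d) false) ≡ false
  -- j + 2 is the length of (10)ᵏ⁺¹0ᵈ⁺¹, so ¬x at j + 2 speaks about exactly that history.
  alternating-zeros-rejected k d
    with release-elim {runOn (alternating (suc k)) (alternating (suc k))} {aTwice} {notXAfterZeros}
           {j = length (alternating k) + suc d}
           (proj₂ (proj₂ (sat (inputs (alternating (suc k)) (alternating (suc k)))))) z≤n
           (λ i _ _ → alternating-no-aTwice (suc k) i)
  ... | inj₁ a≡true = ⊥-elim (not-¬ a≡true (alternating-tail k _ (m<m+n _ z<s)))
  ... | inj₂ (inj₁ a≡true) =
    ⊥-elim (not-¬ a≡true (alternating-tail k _ (m≤n⇒m≤1+n (m<m+n _ z<s))))
  ... | inj₂ (inj₂ x≡false) =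
    trans (cong f₁ (sym (prefix-pad false (alternating (suc k)) (suc d)))) x≡false

  sorted-accepted : ∀ k → f₁ (replicate (suc k) true ++ replicate (suc k) false) ≡ true
  sorted-accepted k = begin
    f₁ (replicate (suc k) true ++ replicate (suc k) false)
      ≡⟨ cong (λ z → f₁ (replicate (suc k) true ++ z)) (++-identityʳ _) ⟨
    f₁ (replicate (suc k) true ++ replicate (suc k) false ++ [])
      ≡⟨ sorted-invariant (suc k) [] [] ⟩
    f₁ (alternating (suc k) ++ [])
      ≡⟨ cong f₁ (++-identityʳ _) ⟩
    f₁ (alternating (suc k))
      ≡⟨ alternating-accepted k ⟩
    true ∎

  sorted-rejected : ∀ {k m} → k < m → f₁ (replicate (suc k) true ++ replicate (suc m) false) ≡ false
  sorted-rejected {k} k<m with m≤n⇒∃[o]m+o≡n k<m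
  ... | d , refl = begin
    f₁ (replicate (suc k) true ++ replicate (suc (suc k + d)) false)
      ≡⟨ cong (λ n → f₁ (replicate (suc k) true ++ replicate n false)) (+-suc (suc k) d) ⟨
    f₁ (replicate (suc k) true ++ replicate (suc k + suc d) false)
      ≡⟨ cong (λ z → f₁ (replicate (suc k) true ++ z)) (replicate-+ (suc k) (suc d) false) ⟩
    f₁ (replicate (suc k) true ++ replicate (suc k) false ++ replicate (suc d) false)
      ≡⟨ sorted-invariant (suc k) [] _ ⟩
    f₁ (alternating (suc k) ++ replicate (suc d) false)
      ≡⟨ alternating-zeros-rejected k d ⟩
    false ∎

¬realizable : ¬ Realizable φ
¬realizable (f₁ , f₂ , f₁-finite , _ , sat)
  with finiteState-collision f₁-finite (λ k → replicate (suc k) true)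
... | i , j , i<j , same-state =
  not-¬ (trans (same-state _) (sorted-accepted j)) (sorted-rejected i<j)
  where open Satisfying f₁ f₂ sat

proposition5p8 : Σ SafeLTL λ φ → ¬ Realizable φ ×
    (∀ (P : List InWord) → Σ Impl λ f₁ → Σ Impl λ f₂ → All (λ σ → run f₁ f₂ σ ⊨ φ) P)
proposition5p8 = φ , ¬realizable , λ P → balanced , balanced , All.universal balanced-realizes P
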